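{- Let $\Phi=(\phi_j)_{j=1}^n$ and $\Psi=(\psi_j)_{j=1}^n$ be $(a,b)$-equiangular systems (same $a,b$) that are frames for a $d$-dimensional non-isotropic space $V$ over $\mathbb{F}$. Then $\Phi$ and $\Psi$ are switching equivalent if and only if $\Delta(\phi_j,\phi_k,\phi_\ell)=\Delta(\psi_j,\psi_k,\psi_\ell)$ for all $j<k<\ell$.
   Context: $\mathbb{F}$ is a finite field of one of two kinds: (Case U) $\mathbb{F}=\mathbb{F}_{q^2}$ with involution $x^\sigma=x^q$, or (Case O) $\mathbb{F}=\mathbb{F}_q$ with $x^\sigma=x$; in both cases $q$ is odd; $\mathbb{F}_0=\{x:x^\sigma=x\}$. A non-isotropic space is a finite-dimensional $\mathbb{F}$-vector space with a non-degenerate Hermitian scalar product $\langle\cdot,\cdot\rangle$ (linear in the second argument, $\langle u,v\rangle=\langle v,u\rangle^\sigma$, non-degenerate). A frame for $V$ is a sequence spanning $V$. An $(a,b)$-equiangular system ($a,b\in\mathbb{F}_0$) satisfies $\langle\phi_j,\phi_j\rangle=a$ for all $j$ and $\langle\phi_j,\phi_k\rangle\langle\phi_k,\phi_j\rangle=b$ for $j\neq k$. A unitary is an invertible linear map $V\to V$ preserving $\langle\cdot,\cdot\rangle$; $\Phi,\Psi$ are switching equivalent if there are a unitary $U$ and $t_1,\dots,t_n$ with $t_it_i^\sigma=1$ and $\psi_j=t_jU\phi_j$ for all $j$. $\Delta(\phi_j,\phi_k,\phi_\ell)=\langle\phi_j,\phi_k\rangle\langle\phi_k,\phi_\ell\rangle\langle\phi_\ell,\phi_j\rangle$.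 -}

module Defs where

open import Level using (Level; _⊔_)
open import Algebra.Bundles using (CommutativeRing)
open import Data.Nat as ℕ using (ℕ; zero; suc)
open import Data.Fin using (Fin; zero; suc)
open import Data.Product using (Σ; ∃; _×_; _,_)
open import Data.Sum using (_⊎_)
open import Relation.Binary.PropositionalEquality using (_≡_)
open import Relation.Nullary using (¬_)

module Herm {c ℓ : Level} (R : CommutativeRing c ℓ) (σ : CommutativeRing.Carrier R → CommutativeRing.Carrier R) where
  open CommutativeRing R hiding (zero)

  IsField : Set (c ⊔ ℓ)
  IsField = (¬ (0# ≈ 1#)) × (∀ x → ¬ (x ≈ 0#) → ∃ λ y → x * y ≈ 1#)

  pow : Carrier → ℕ → Carrier
  pow x zero = 1#
  pow x (suc m) = x * pow x m

  HasCard : ℕ → Set (c ⊔ ℓ)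
  HasCard N = Σ (Fin N → Carrier) λ e →
    (∀ x → ∃ λ i → e i ≈ x) × (∀ i j → e i ≈ e j → i ≡ j)

  Odd : ℕ → Set
  Odd q = ∃ λ k → q ≡ suc (2 ℕ.* k)

  CaseU : ℕ → Set (c ⊔ ℓ)
  CaseU q = HasCard (q ℕ.* q) × (∀ x → σ x ≈ pow x q)

  CaseO : ℕ → Set (c ⊔ ℓ)
  CaseO q = HasCard q × (∀ x → σ x ≈ x)

  ∑ : (m : ℕ) → (Fin m → Carrier) → Carrier
  ∑ zero f = 0#
  ∑ (suc m) f = f zero + ∑ m (λ i → f (suc i))

  -- the d-dimensional space F^d (every d-dimensional F-space is isomorphic to it)
  Vec : ℕ → Set c
  Vec d = Fin d → Carrier

  module _ {d : ℕ} where
    _≈ᵥ_ : Vec d → Vec d → Set ℓ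
    u ≈ᵥ v = ∀ i → u i ≈ v i

    _+ᵥ_ : Vec d → Vec d → Vec d
    (u +ᵥ v) i = u i + v i

    _·_ : Carrier → Vec d → Vec d
    (x · v) i = x * v i

    0ᵥ : Vec d
    0ᵥ i = 0#

    record IsHermitianForm (B : Vec d → Vec d → Carrier) : Set (c ⊔ ℓ) where
      field
        cong     : ∀ {u u′ v v′} → u ≈ᵥ u′ → v ≈ᵥ v′ → B u v ≈ B u′ v′
        additive : ∀ u v w → B u (v +ᵥ w) ≈ B u v + B u w
        homog    : ∀ x u v → B u (x · v) ≈ x * B u v
        hermitian : ∀ u v → B u v ≈ σ (B v u)
        nondegenerate : ∀ u → (∀ v → B u v ≈ 0#) → u ≈ᵥ 0ᵥ

    lincomb : {n : ℕ} → (Fin n → Carrier) → (Fin n → Vec d) → Vec d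
    lincomb {n} cs φ i = ∑ n (λ j → cs j * φ j i)

    IsFrame : {n : ℕ} → (Fin n → Vec d) → Set (c ⊔ ℓ)
    IsFrame {n} φ = ∀ v → ∃ λ (cs : Fin n → Carrier) → v ≈ᵥ lincomb cs φ

    module _ (B : Vec d → Vec d → Carrier) where
      IsEquiangular : {n : ℕ} → Carrier → Carrier → (Fin n → Vec d) → Set ℓ
      IsEquiangular a b φ =
        (∀ j → B (φ j) (φ j) ≈ a) ×
        (∀ j k → ¬ (j ≡ k) → B (φ j) (φ k) * B (φ k) (φ j) ≈ b)

      IsUnitary : (Vec d → Vec d) → Set (c ⊔ ℓ)
      IsUnitary U =
        (∀ {u v} → u ≈ᵥ v → U u ≈ᵥ U v) ×
        (∀ u v → U (u +ᵥ v) ≈ᵥ (U u +ᵥ U v)) ×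
        (∀ x u → U (x · u) ≈ᵥ (x · U u)) ×
        (∃ λ (W : Vec d → Vec d) → (∀ u → U (W u) ≈ᵥ u) × (∀ u → W (U u) ≈ᵥ u)) ×
        (∀ u v → B (U u) (U v) ≈ B u v)

      SwitchingEquivalent : {n : ℕ} → (Fin n → Vec d) → (Fin n → Vec d) → Set (c ⊔ ℓ)
      SwitchingEquivalent {n} φ ψ =
        ∃ λ (U : Vec d → Vec d) → IsUnitary U ×
          (∃ λ (t : Fin n → Carrier) →
             (∀ j → t j * σ (t j) ≈ 1#) × (∀ j → ψ j ≈ᵥ (t j · U (φ j))))

      Δ : Vec d → Vec d → Vec d → Carrier
      Δ x y z = B x y * B y z * B z x

-- Both conditions are equivalent to the Gram matrices being related by a diagonal unitary:
-- ⟨ψₖ, ψⱼ⟩ = tₖ^σ tⱼ ⟨φₖ, φⱼ⟩ with tⱼ tⱼ^σ = 1. Given such t, the map u ↦ Σⱼ cⱼ tⱼ^σ ψⱼ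
-- (cⱼ the coefficients of u in the frame φ) is well defined and unitary because both frames
-- separate points, and it sends φⱼ to tⱼ^σ ψⱼ. Conversely the triple products are invariant
-- under such rescalings. For the remaining implication, if b = 0 both Gram matrices equal a·I;
-- otherwise normalise against the first vector, tⱼ = ⟨ψ₀, ψⱼ⟩⟨φⱼ, φ₀⟩ / b, and read every other
-- entry ⟨ψₖ, ψⱼ⟩ off Δ(ψ₀, ψₖ, ψⱼ) = Δ(φ₀, φₖ, φⱼ), using ⟨ψ₀, ψₖ⟩⟨ψₖ, ψ₀⟩ = b.
module Submission where

open import Defs
open import Level using (Level; _⊔_)
open import Algebra.Bundles using (CommutativeRing)
open import Algebra.Morphism.Structures using (module MonoidMorphisms)
open import Data.Nat as ℕ using (ℕ; z<s; s<s)
open import Data.Fin using (Fin; _<_) renaming (zero to fzero; suc to fsuc)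
open import Data.Fin.Properties using (_≟_; <-cmp)
open import Data.Sum using (_⊎_; inj₁; inj₂)
open import Data.Product using (∃; _×_; _,_; proj₁; proj₂)
open import Data.Empty using (⊥-elim)
open import Relation.Nullary using (¬_; yes; no)
open import Relation.Binary.Definitions using (Decidable; tri<; tri≈; tri>)
open import Relation.Binary.PropositionalEquality as ≡ using (_≢_)
open import Function.Bundles using (_⇔_; mk⇔)
open import Function.Construct.Composition using (_⇔-∘_)

module Switching {c ℓ : Level} (R : CommutativeRing c ℓ)
  (σ : CommutativeRing.Carrier R → CommutativeRing.Carrier R) where

  open CommutativeRing R hiding (zero)
  open Herm R σ
  open import Relation.Binary.Reasoning.Setoid setoid
  open import Algebra.Solver.Ring.NaturalCoefficients.Default commutativeSemiring
  open import Algebra.Properties.Ring ring using (-1*x≈-x)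
  open import Algebra.Properties.Group +-group using (x∙y⁻¹≈ε⇒x≈y)
  open import Algebra.Properties.CommutativeSemigroup *-commutativeSemigroup using (x∙yz≈y∙xz)
  open MonoidMorphisms *-rawMonoid *-rawMonoid using (IsMonoidHomomorphism)

  pow-cong : ∀ {x y} m → x ≈ y → pow x m ≈ pow y m
  pow-cong ℕ.zero    x≈y = refl
  pow-cong (ℕ.suc m) x≈y = *-cong x≈y (pow-cong m x≈y)

  pow-distrib-* : ∀ x y m → pow (x * y) m ≈ pow x m * pow y m
  pow-distrib-* x y ℕ.zero    = sym (*-identityˡ 1#)
  pow-distrib-* x y (ℕ.suc m) = begin
    x * y * pow (x * y) m         ≈⟨ *-congˡ (pow-distrib-* x y m) ⟩
    x * y * (pow x m * pow y m)   ≈⟨ solve 4 (λ x y u v → x :* y :* (u :* v) := x :* u :* (y :* v))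
                                             refl x y (pow x m) (pow y m) ⟩
    x * pow x m * (y * pow y m)   ∎

  pow-1# : ∀ m → pow 1# m ≈ 1#
  pow-1# ℕ.zero    = refl
  pow-1# (ℕ.suc m) = trans (*-identityˡ _) (pow-1# m)

  σ-isMonoidHomomorphism : ∀ q → CaseU q ⊎ CaseO q → IsMonoidHomomorphism σ
  σ-isMonoidHomomorphism q (inj₁ (_ , σ≈pow)) = record
    { isMagmaHomomorphism = record
      { isRelHomomorphism = record
        { cong = λ {x} {y} x≈y → trans (σ≈pow x) (trans (pow-cong q x≈y) (sym (σ≈pow y))) }
      ; homo = λ x y → trans (σ≈pow _) (trans (pow-distrib-* x y q) (sym (*-cong (σ≈pow x) (σ≈pow y))))
      }
    ; ε-homo = trans (σ≈pow 1#) (pow-1# q)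
    }
  σ-isMonoidHomomorphism q (inj₂ (_ , σ≈id)) = record
    { isMagmaHomomorphism = record
      { isRelHomomorphism = record
        { cong = λ {x} {y} x≈y → trans (σ≈id x) (trans x≈y (sym (σ≈id y))) }
      ; homo = λ x y → trans (σ≈id _) (sym (*-cong (σ≈id x) (σ≈id y)))
      }
    ; ε-homo = σ≈id 1#
    }

  -- In case U this is 0^q ≈ 0, the one place where q ≥ 1 (here: q odd) is needed.
  σ-0# : ∀ q → Odd q → CaseU q ⊎ CaseO q → σ 0# ≈ 0#
  σ-0# q (_ , ≡.refl) (inj₁ (_ , σ≈pow)) = trans (σ≈pow 0#) (zeroˡ _)
  σ-0# q _            (inj₂ (_ , σ≈id))  = σ≈id 0#

  hasCard⇒decidable : ∀ {N} → HasCard N → Decidable _≈_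
  hasCard⇒decidable (e , onto , injective) x y with onto x | onto y
  ... | i , eᵢ≈x | j , eⱼ≈y with i ≟ j
  ...   | yes ≡.refl = yes (trans (sym eᵢ≈x) eⱼ≈y)
  ...   | no i≢j     = no λ x≈y → i≢j (injective i j (trans eᵢ≈x (trans x≈y (sym eⱼ≈y))))

  case⇒decidable : ∀ q → CaseU q ⊎ CaseO q → Decidable _≈_
  case⇒decidable q (inj₁ (card , _)) = hasCard⇒decidable card
  case⇒decidable q (inj₂ (card , _)) = hasCard⇒decidable card

  field-zero-product : IsField → Decidable _≈_ → ∀ {x y} → x * y ≈ 0# → x ≈ 0# ⊎ y ≈ 0#
  field-zero-product (_ , inverse) _≟₀_ {x} {y} xy≈0 with x ≟₀ 0#
  ... | yes x≈0 = inj₁ x≈0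
  ... | no x≉0 with inverse x x≉0
  ...   | x⁻¹ , xx⁻¹≈1 = inj₂ (begin
    y                ≈⟨ sym (*-identityˡ y) ⟩
    1# * y           ≈⟨ *-congʳ (sym xx⁻¹≈1) ⟩
    x * x⁻¹ * y      ≈⟨ solve 3 (λ x x⁻¹ y → x :* x⁻¹ :* y := x⁻¹ :* (x :* y)) refl x x⁻¹ y ⟩
    x⁻¹ * (x * y)    ≈⟨ *-congˡ xy≈0 ⟩
    x⁻¹ * 0#         ≈⟨ zeroʳ x⁻¹ ⟩
    0#               ∎)

  ∑-cong : ∀ m {f g : Fin m → Carrier} → (∀ i → f i ≈ g i) → ∑ m f ≈ ∑ m g
  ∑-cong ℕ.zero    f≈g = refl
  ∑-cong (ℕ.suc m) f≈g = +-cong (f≈g fzero) (∑-cong m (λ i → f≈g (fsuc i)))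

  *-distribˡ-∑ : ∀ m x (f : Fin m → Carrier) → x * ∑ m f ≈ ∑ m (λ i → x * f i)
  *-distribˡ-∑ ℕ.zero    x f = zeroʳ x
  *-distribˡ-∑ (ℕ.suc m) x f = trans (distribˡ x _ _) (+-congˡ (*-distribˡ-∑ m x (λ i → f (fsuc i))))

  ∑-zero : ∀ m {f : Fin m → Carrier} → (∀ i → f i ≈ 0#) → ∑ m f ≈ 0#
  ∑-zero ℕ.zero    f≈0 = refl
  ∑-zero (ℕ.suc m) f≈0 = trans (+-cong (f≈0 fzero) (∑-zero m (λ i → f≈0 (fsuc i)))) (+-identityˡ 0#)

  IsUnimodular : ∀ {n} → (Fin n → Carrier) → Set ℓ
  IsUnimodular t = ∀ j → t j * σ (t j) ≈ 1#

  module _ {d : ℕ} (B : Vec d → Vec d → Carrier) where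

    GramRelated : ∀ {n} → (Fin n → Carrier) → (Fin n → Vec d) → (Fin n → Vec d) → Set ℓ
    GramRelated t φ ψ = ∀ k j → B (ψ k) (ψ j) ≈ σ (t k) * t j * B (φ k) (φ j)

    GramEquivalent : ∀ {n} → (Fin n → Vec d) → (Fin n → Vec d) → Set (c ⊔ ℓ)
    GramEquivalent φ ψ = ∃ λ t → IsUnimodular t × GramRelated t φ ψ

    TriplesAgree : ∀ {n} → (Fin n → Vec d) → (Fin n → Vec d) → Set ℓ
    TriplesAgree {n} φ ψ = ∀ (j k l : Fin n) → j < k → k < l →
      Δ B (φ j) (φ k) (φ l) ≈ Δ B (ψ j) (ψ k) (ψ l)

  module Form (σ-hom : IsMonoidHomomorphism σ) (σ-0 : σ 0# ≈ 0#)
    {d : ℕ} {B : Vec d → Vec d → Carrier} (isHermitian : IsHermitianForm B) where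

    open IsMonoidHomomorphism σ-hom renaming (⟦⟧-cong to σ-cong; homo to σ-*; ε-homo to σ-1)
    open IsHermitianForm isHermitian

    ≈ᵥ-refl : {u : Vec d} → u ≈ᵥ u
    ≈ᵥ-refl i = refl

    σ-B : ∀ u v → σ (B u v) ≈ B v u
    σ-B u v = sym (hermitian v u)

    σ-scaled : ∀ x u v → σ (x * B u v) ≈ σ x * B v u
    σ-scaled x u v = trans (σ-* x _) (*-congˡ (σ-B u v))

    homogˡ : ∀ x u v → B (x · u) v ≈ σ x * B u v
    homogˡ x u v = trans (hermitian _ _) (trans (σ-cong (homog x v u)) (σ-scaled x v u))

    B-0ᵥ : ∀ w → B w 0ᵥ ≈ 0#
    B-0ᵥ w = begin
      B w 0ᵥ           ≈⟨ cong ≈ᵥ-refl (λ i → sym (zeroˡ 0#)) ⟩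
      B w (0# · 0ᵥ)    ≈⟨ homog 0# w 0ᵥ ⟩
      0# * B w 0ᵥ      ≈⟨ zeroˡ _ ⟩
      0#               ∎

    B-lincomb : ∀ {n} w (cs : Fin n → Carrier) (χ : Fin n → Vec d) →
      B w (lincomb cs χ) ≈ ∑ n (λ j → cs j * B w (χ j))
    B-lincomb {ℕ.zero}  w cs χ = B-0ᵥ w
    B-lincomb {ℕ.suc n} w cs χ = trans (additive w _ _)
      (+-cong (homog _ _ _) (B-lincomb w (λ j → cs (fsuc j)) (λ j → χ (fsuc j))))

    B-lincomb-rescale : ∀ {n w w′} {χ χ′ : Fin n → Vec d} x (e cs : Fin n → Carrier) →
      (∀ j → e j * B w (χ j) ≈ x * B w′ (χ′ j)) →
      B w (lincomb (λ j → cs j * e j) χ) ≈ x * B w′ (lincomb cs χ′)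
    B-lincomb-rescale {n} {w} {w′} {χ} {χ′} x e cs rescale = begin
      B w (lincomb (λ j → cs j * e j) χ)     ≈⟨ B-lincomb w _ χ ⟩
      ∑ n (λ j → cs j * e j * B w (χ j))     ≈⟨ ∑-cong n (λ j → begin
          cs j * e j * B w (χ j)                 ≈⟨ *-assoc _ _ _ ⟩
          cs j * (e j * B w (χ j))               ≈⟨ *-congˡ (rescale j) ⟩
          cs j * (x * B w′ (χ′ j))               ≈⟨ x∙yz≈y∙xz _ _ _ ⟩
          x * (cs j * B w′ (χ′ j))               ∎) ⟩
      ∑ n (λ j → x * (cs j * B w′ (χ′ j)))   ≈⟨ sym (*-distribˡ-∑ n x _) ⟩
      x * ∑ n (λ j → cs j * B w′ (χ′ j))     ≈⟨ *-congˡ (sym (B-lincomb w′ cs χ′)) ⟩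
      x * B w′ (lincomb cs χ′)               ∎

    frame-separates : ∀ {n} {χ : Fin n → Vec d} → IsFrame χ →
      ∀ {X Y} → (∀ k → B (χ k) X ≈ B (χ k) Y) → X ≈ᵥ Y
    frame-separates {n} {χ} frame {X} {Y} χX≈χY i =
      x∙y⁻¹≈ε⇒x≈y (X i) (Y i) (trans (+-congˡ (sym (-1*x≈-x (Y i)))) (nondegenerate D D⊥ i))
      where
      D : Vec d
      D = X +ᵥ ((- 1#) · Y)

      χ⊥D : ∀ k → B (χ k) D ≈ 0#
      χ⊥D k = begin
        B (χ k) D                                ≈⟨ additive _ _ _ ⟩
        B (χ k) X + B (χ k) ((- 1#) · Y)         ≈⟨ +-cong (χX≈χY k) (homog _ _ _) ⟩
        B (χ k) Y + (- 1#) * B (χ k) Y           ≈⟨ +-congˡ (-1*x≈-x _) ⟩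
        B (χ k) Y + - B (χ k) Y                  ≈⟨ -‿inverseʳ _ ⟩
        0#                                       ∎

      D⊥ : ∀ v → B D v ≈ 0#
      D⊥ v = begin
        B D v                                    ≈⟨ cong ≈ᵥ-refl (proj₂ (frame v)) ⟩
        B D (lincomb (proj₁ (frame v)) χ)        ≈⟨ B-lincomb D _ χ ⟩
        ∑ n (λ j → proj₁ (frame v) j * B D (χ j)) ≈⟨ ∑-zero n (λ j →
          trans (*-congˡ (trans (hermitian _ _) (trans (σ-cong (χ⊥D j)) σ-0))) (zeroʳ _)) ⟩
        0#                                       ∎

    switching⇒gramEquivalent : ∀ {n} {φ ψ : Fin n → Vec d} →
      SwitchingEquivalent B φ ψ → GramEquivalent B φ ψ
    switching⇒gramEquivalent {φ = φ} {ψ} (U , (_ , _ , _ , _ , U-preserves) , t , t-unit , ψ≈tUφ) =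
      t , t-unit , λ k j → begin
        B (ψ k) (ψ j)                            ≈⟨ cong (ψ≈tUφ k) (ψ≈tUφ j) ⟩
        B (t k · U (φ k)) (t j · U (φ j))        ≈⟨ homogˡ _ _ _ ⟩
        σ (t k) * B (U (φ k)) (t j · U (φ j))    ≈⟨ *-congˡ (homog _ _ _) ⟩
        σ (t k) * (t j * B (U (φ k)) (U (φ j)))  ≈⟨ *-congˡ (*-congˡ (U-preserves _ _)) ⟩
        σ (t k) * (t j * B (φ k) (φ j))          ≈⟨ sym (*-assoc _ _ _) ⟩
        σ (t k) * t j * B (φ k) (φ j)            ∎

    gramEquivalent⇒triplesAgree : ∀ {n} {φ ψ : Fin n → Vec d} →
      GramEquivalent B φ ψ → TriplesAgree B φ ψ
    gramEquivalent⇒triplesAgree {φ = φ} {ψ} (t , t-unit , gram) j k l _ _ = sym (begin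
      H j k * H k l * H l j
        ≈⟨ *-cong (*-cong (gram j k) (gram k l)) (gram l j) ⟩
      σ (t j) * t k * G j k * (σ (t k) * t l * G k l) * (σ (t l) * t j * G l j)
        ≈⟨ solve 9 (λ tj tk tl sj sk sl x y z →
             sj :* tk :* x :* (sk :* tl :* y) :* (sl :* tj :* z) :=
             x :* y :* z :* (tj :* sj :* (tk :* sk :* (tl :* sl))))
           refl (t j) (t k) (t l) (σ (t j)) (σ (t k)) (σ (t l)) (G j k) (G k l) (G l j) ⟩
      G j k * G k l * G l j * (t j * σ (t j) * (t k * σ (t k) * (t l * σ (t l))))
        ≈⟨ *-congˡ (*-cong (t-unit j) (*-cong (t-unit k) (t-unit l))) ⟩
      G j k * G k l * G l j * (1# * (1# * 1#))
        ≈⟨ *-congˡ (trans (*-identityˡ _) (*-identityˡ _)) ⟩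
      G j k * G k l * G l j * 1#
        ≈⟨ *-identityʳ _ ⟩
      G j k * G k l * G l j ∎)
      where
      G H : Fin _ → Fin _ → Carrier
      G k j = B (φ k) (φ j)
      H k j = B (ψ k) (ψ j)

    module Unitary {n} {φ ψ : Fin n → Vec d} (frameφ : IsFrame φ) (frameψ : IsFrame ψ)
      {t : Fin n → Carrier} (t-unit : IsUnimodular t) (gram : GramRelated B t φ ψ) where

      U W : Vec d → Vec d
      U u = lincomb (λ j → proj₁ (frameφ u) j * σ (t j)) ψ
      W v = lincomb (λ j → proj₁ (frameψ v) j * t j) φ

      ψ-U : ∀ k u → B (ψ k) (U u) ≈ σ (t k) * B (φ k) u
      ψ-U k u = trans (B-lincomb-rescale (σ (t k)) (λ j → σ (t j)) _ λ j → begin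
          σ (t j) * B (ψ k) (ψ j)                    ≈⟨ *-congˡ (gram k j) ⟩
          σ (t j) * (σ (t k) * t j * B (φ k) (φ j))  ≈⟨ solve 4 (λ sj sk tj g →
                                                          sj :* (sk :* tj :* g) := sk :* g :* (tj :* sj))
                                                        refl (σ (t j)) (σ (t k)) (t j) (B (φ k) (φ j)) ⟩
          σ (t k) * B (φ k) (φ j) * (t j * σ (t j))  ≈⟨ *-congˡ (t-unit j) ⟩
          σ (t k) * B (φ k) (φ j) * 1#               ≈⟨ *-identityʳ _ ⟩
          σ (t k) * B (φ k) (φ j)                    ∎)
        (*-congˡ (cong ≈ᵥ-refl (λ i → sym (proj₂ (frameφ u) i))))

      φ-W : ∀ k v → B (φ k) (W v) ≈ t k * B (ψ k) v
      φ-W k v = trans (B-lincomb-rescale (t k) t _ λ j → sym (begin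
          t k * B (ψ k) (ψ j)                        ≈⟨ *-congˡ (gram k j) ⟩
          t k * (σ (t k) * t j * B (φ k) (φ j))      ≈⟨ solve 4 (λ tk sk tj g →
                                                          tk :* (sk :* tj :* g) := tj :* g :* (tk :* sk))
                                                        refl (t k) (σ (t k)) (t j) (B (φ k) (φ j)) ⟩
          t j * B (φ k) (φ j) * (t k * σ (t k))      ≈⟨ *-congˡ (t-unit k) ⟩
          t j * B (φ k) (φ j) * 1#                   ≈⟨ *-identityʳ _ ⟩
          t j * B (φ k) (φ j)                        ∎))
        (*-congˡ (cong ≈ᵥ-refl (λ i → sym (proj₂ (frameψ v) i))))

      U-cong : ∀ {u v} → u ≈ᵥ v → U u ≈ᵥ U v
      U-cong {u} {v} u≈v = frame-separates frameψ λ k →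
        trans (ψ-U k u) (trans (*-congˡ (cong ≈ᵥ-refl u≈v)) (sym (ψ-U k v)))

      U-+ : ∀ u v → U (u +ᵥ v) ≈ᵥ (U u +ᵥ U v)
      U-+ u v = frame-separates frameψ λ k → begin
        B (ψ k) (U (u +ᵥ v))                      ≈⟨ ψ-U k _ ⟩
        σ (t k) * B (φ k) (u +ᵥ v)                ≈⟨ *-congˡ (additive _ _ _) ⟩
        σ (t k) * (B (φ k) u + B (φ k) v)         ≈⟨ distribˡ _ _ _ ⟩
        σ (t k) * B (φ k) u + σ (t k) * B (φ k) v ≈⟨ +-cong (ψ-U k u) (ψ-U k v) ⟨
        B (ψ k) (U u) + B (ψ k) (U v)             ≈⟨ additive _ _ _ ⟨
        B (ψ k) (U u +ᵥ U v)                      ∎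

      U-· : ∀ x u → U (x · u) ≈ᵥ (x · U u)
      U-· x u = frame-separates frameψ λ k → begin
        B (ψ k) (U (x · u))                       ≈⟨ ψ-U k _ ⟩
        σ (t k) * B (φ k) (x · u)                 ≈⟨ *-congˡ (homog _ _ _) ⟩
        σ (t k) * (x * B (φ k) u)                 ≈⟨ x∙yz≈y∙xz _ _ _ ⟩
        x * (σ (t k) * B (φ k) u)                 ≈⟨ *-congˡ (ψ-U k u) ⟨
        x * B (ψ k) (U u)                         ≈⟨ homog _ _ _ ⟨
        B (ψ k) (x · U u)                         ∎

      U∘W : ∀ v → U (W v) ≈ᵥ v
      U∘W v = frame-separates frameψ λ k → begin
        B (ψ k) (U (W v))                         ≈⟨ ψ-U k _ ⟩
        σ (t k) * B (φ k) (W v)                   ≈⟨ *-congˡ (φ-W k v) ⟩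
        σ (t k) * (t k * B (ψ k) v)               ≈⟨ *-assoc _ _ _ ⟨
        σ (t k) * t k * B (ψ k) v                 ≈⟨ *-congʳ (trans (*-comm _ _) (t-unit k)) ⟩
        1# * B (ψ k) v                            ≈⟨ *-identityˡ _ ⟩
        B (ψ k) v                                 ∎

      W∘U : ∀ u → W (U u) ≈ᵥ u
      W∘U u = frame-separates frameφ λ k → begin
        B (φ k) (W (U u))                         ≈⟨ φ-W k _ ⟩
        t k * B (ψ k) (U u)                       ≈⟨ *-congˡ (ψ-U k u) ⟩
        t k * (σ (t k) * B (φ k) u)               ≈⟨ *-assoc _ _ _ ⟨
        t k * σ (t k) * B (φ k) u                 ≈⟨ *-congʳ (t-unit k) ⟩
        1# * B (φ k) u                            ≈⟨ *-identityˡ _ ⟩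
        B (φ k) u                                 ∎

      U-preserves : ∀ u v → B (U u) (U v) ≈ B u v
      U-preserves u v = trans (B-lincomb-rescale 1# (λ j → σ (t j)) _ λ k → begin
          σ (t k) * B (U u) (ψ k)                    ≈⟨ *-congˡ (hermitian _ _) ⟩
          σ (t k) * σ (B (ψ k) (U u))                ≈⟨ *-congˡ (σ-cong (ψ-U k u)) ⟩
          σ (t k) * σ (σ (t k) * B (φ k) u)          ≈⟨ *-congˡ (σ-scaled _ _ _) ⟩
          σ (t k) * (σ (σ (t k)) * B u (φ k))        ≈⟨ *-assoc _ _ _ ⟨
          σ (t k) * σ (σ (t k)) * B u (φ k)          ≈⟨ *-congʳ (σ-* _ _) ⟨
          σ (t k * σ (t k)) * B u (φ k)              ≈⟨ *-congʳ (trans (σ-cong (t-unit k)) σ-1) ⟩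
          1# * B u (φ k)                             ∎)
        (trans (*-identityˡ _) (cong ≈ᵥ-refl (λ i → sym (proj₂ (frameφ v) i))))

      ψ≈t·Uφ : ∀ j → ψ j ≈ᵥ (t j · U (φ j))
      ψ≈t·Uφ j = frame-separates frameψ λ k → begin
        B (ψ k) (ψ j)                             ≈⟨ gram k j ⟩
        σ (t k) * t j * B (φ k) (φ j)             ≈⟨ *-congʳ (*-comm _ _) ⟩
        t j * σ (t k) * B (φ k) (φ j)             ≈⟨ *-assoc _ _ _ ⟩
        t j * (σ (t k) * B (φ k) (φ j))           ≈⟨ *-congˡ (ψ-U k (φ j)) ⟨
        t j * B (ψ k) (U (φ j))                   ≈⟨ homog _ _ _ ⟨
        B (ψ k) (t j · U (φ j))                   ∎

    switching⇔gramEquivalent : ∀ {n} {φ ψ : Fin n → Vec d} → IsFrame φ → IsFrame ψ →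
      SwitchingEquivalent B φ ψ ⇔ GramEquivalent B φ ψ
    switching⇔gramEquivalent frameφ frameψ = mk⇔ switching⇒gramEquivalent λ where
      (t , t-unit , gram) → let open Unitary frameφ frameψ t-unit gram in
        U , (U-cong , U-+ , U-· , (W , U∘W , W∘U) , U-preserves) , t , t-unit , ψ≈t·Uφ

    Δ-swap : ∀ x y z → Δ B x z y ≈ σ (Δ B x y z)
    Δ-swap x y z = sym (begin
      σ (B x y * B y z * B z x)          ≈⟨ σ-* _ _ ⟩
      σ (B x y * B y z) * σ (B z x)      ≈⟨ *-congʳ (σ-* _ _) ⟩
      σ (B x y) * σ (B y z) * σ (B z x)  ≈⟨ *-cong (*-cong (σ-B x y) (σ-B y z)) (σ-B z x) ⟩
      B y x * B z y * B x z              ≈⟨ solve 3 (λ u v w → u :* v :* w := w :* v :* u)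
                                              refl (B y x) (B z y) (B x z) ⟩
      B x z * B z y * B y x              ∎)

    triplesAgree⇒Δ₀-agree : ∀ {m} {φ ψ : Fin (ℕ.suc m) → Vec d} → TriplesAgree B φ ψ →
      ∀ {k j} → k ≢ j →
      Δ B (φ fzero) (φ (fsuc k)) (φ (fsuc j)) ≈ Δ B (ψ fzero) (ψ (fsuc k)) (ψ (fsuc j))
    triplesAgree⇒Δ₀-agree agree {k} {j} k≢j with <-cmp k j
    ... | tri< k<j _ _ = agree _ _ _ z<s (s<s k<j)
    ... | tri≈ _ k≡j _ = ⊥-elim (k≢j k≡j)
    ... | tri> _ _ j<k =
      trans (Δ-swap _ _ _) (trans (σ-cong (agree _ _ _ z<s (s<s j<k))) (sym (Δ-swap _ _ _)))

    module Equiangular (isField : IsField) (_≟₀_ : Decidable _≈_) {a b : Carrier} (σb≈b : σ b ≈ b) where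

      diagonal-related : ∀ {n} {φ ψ : Fin n → Vec d} → IsEquiangular B a b φ → IsEquiangular B a b ψ →
        ∀ {t} → IsUnimodular t → ∀ k → B (ψ k) (ψ k) ≈ σ (t k) * t k * B (φ k) (φ k)
      diagonal-related {φ = φ} {ψ} (φφ≈a , _) (ψψ≈a , _) {t} t-unit k = begin
        B (ψ k) (ψ k)                  ≈⟨ trans (ψψ≈a k) (sym (φφ≈a k)) ⟩
        B (φ k) (φ k)                  ≈⟨ *-identityˡ _ ⟨
        1# * B (φ k) (φ k)             ≈⟨ *-congʳ (trans (*-comm _ _) (t-unit k)) ⟨
        σ (t k) * t k * B (φ k) (φ k)  ∎

      off-diagonal-zero : ∀ {n} {χ : Fin n → Vec d} → IsEquiangular B a b χ → b ≈ 0# →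
        ∀ {k j} → k ≢ j → B (χ k) (χ j) ≈ 0#
      off-diagonal-zero (_ , |χ|²≈b) b≈0 k≢j
        with field-zero-product isField _≟₀_ (trans (|χ|²≈b _ _ k≢j) b≈0)
      ... | inj₁ χₖχⱼ≈0 = χₖχⱼ≈0
      ... | inj₂ χⱼχₖ≈0 = trans (hermitian _ _) (trans (σ-cong χⱼχₖ≈0) σ-0)

      orthogonal⇒gramEquivalent : ∀ {n} {φ ψ : Fin n → Vec d} →
        IsEquiangular B a b φ → IsEquiangular B a b ψ → b ≈ 0# → GramEquivalent B φ ψ
      orthogonal⇒gramEquivalent {φ = φ} {ψ} eqφ eqψ b≈0 = (λ _ → 1#) , one-unit , gram
        where
        one-unit : IsUnimodular (λ _ → 1#)
        one-unit _ = trans (*-identityˡ _) σ-1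

        gram : GramRelated B (λ _ → 1#) φ ψ
        gram k j with k ≟ j
        ... | yes ≡.refl = diagonal-related eqφ eqψ one-unit k
        ... | no k≢j     = trans (off-diagonal-zero eqψ b≈0 k≢j)
                             (sym (trans (*-congˡ (off-diagonal-zero eqφ b≈0 k≢j)) (zeroʳ _)))

      module Normalised {m} {φ ψ : Fin (ℕ.suc m) → Vec d}
        (eqφ : IsEquiangular B a b φ) (eqψ : IsEquiangular B a b ψ) (b≉0 : ¬ b ≈ 0#) where

        G H : Fin (ℕ.suc m) → Fin (ℕ.suc m) → Carrier
        G k j = B (φ k) (φ j)
        H k j = B (ψ k) (ψ j)

        |G|² : ∀ {k j} → k ≢ j → G k j * G j k ≈ b
        |G|² = proj₂ eqφ _ _

        |H|² : ∀ {k j} → k ≢ j → H k j * H j k ≈ b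
        |H|² = proj₂ eqψ _ _

        β : Carrier
        β = proj₁ (proj₂ isField b b≉0)

        bβ≈1 : b * β ≈ 1#
        bβ≈1 = proj₂ (proj₂ isField b b≉0)

        σβb≈1 : σ β * b ≈ 1#
        σβb≈1 = begin
          σ β * b    ≈⟨ *-congˡ σb≈b ⟨
          σ β * σ b  ≈⟨ σ-* β b ⟨
          σ (β * b)  ≈⟨ σ-cong (trans (*-comm β b) bβ≈1) ⟩
          σ 1#       ≈⟨ σ-1 ⟩
          1#         ∎

        t : Fin (ℕ.suc m) → Carrier
        t fzero    = 1#
        t (fsuc j) = H fzero (fsuc j) * G (fsuc j) fzero * β

        σ-t : ∀ j → σ (t (fsuc j)) ≈ H (fsuc j) fzero * G fzero (fsuc j) * σ β
        σ-t j = trans (σ-* _ _) (*-congʳ (trans (σ-* _ _) (*-cong (σ-B _ _) (σ-B _ _))))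

        t-unit : IsUnimodular t
        t-unit fzero    = trans (*-identityˡ _) σ-1
        t-unit (fsuc k) = begin
          t K * σ (t K)                                  ≈⟨ *-congˡ (σ-t k) ⟩
          H₀ₖ * G K fzero * β * (H K fzero * G₀ₖ * σ β)  ≈⟨ solve 6 (λ h h′ g g′ x y →
                                                              h :* g′ :* x :* (h′ :* g :* y) :=
                                                              h :* h′ :* x :* (y :* (g :* g′)))
                                                            refl H₀ₖ (H K fzero) G₀ₖ (G K fzero) β (σ β) ⟩
          H₀ₖ * H K fzero * β * (σ β * (G₀ₖ * G K fzero)) ≈⟨ *-cong (*-congʳ (|H|² λ ())) (*-congˡ (|G|² λ ())) ⟩
          b * β * (σ β * b)                              ≈⟨ *-cong bβ≈1 σβb≈1 ⟩
          1# * 1#                                        ≈⟨ *-identityˡ 1# ⟩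
          1#                                             ∎
          where K = fsuc k; H₀ₖ = H fzero K; G₀ₖ = G fzero K

        gram-0ⱼ : ∀ j → H fzero (fsuc j) ≈ σ (t fzero) * t (fsuc j) * G fzero (fsuc j)
        gram-0ⱼ j = sym (begin
          σ 1# * (H₀ⱼ * G J fzero * β) * G₀ⱼ  ≈⟨ *-congʳ (trans (*-congʳ σ-1) (*-identityˡ _)) ⟩
          H₀ⱼ * G J fzero * β * G₀ⱼ           ≈⟨ solve 4 (λ h g g′ x → h :* g′ :* x :* g := h :* (g :* g′ :* x))
                                                  refl H₀ⱼ G₀ⱼ (G J fzero) β ⟩
          H₀ⱼ * (G₀ⱼ * G J fzero * β)         ≈⟨ *-congˡ (*-congʳ (|G|² λ ())) ⟩
          H₀ⱼ * (b * β)                       ≈⟨ *-congˡ bβ≈1 ⟩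
          H₀ⱼ * 1#                            ≈⟨ *-identityʳ _ ⟩
          H₀ⱼ                                 ∎)
          where J = fsuc j; H₀ⱼ = H fzero J; G₀ⱼ = G fzero J

        gram-ₖ0 : ∀ k → H (fsuc k) fzero ≈ σ (t (fsuc k)) * t fzero * G (fsuc k) fzero
        gram-ₖ0 k = sym (begin
          σ (t K) * 1# * Gₖ₀                  ≈⟨ *-congʳ (trans (*-identityʳ _) (σ-t k)) ⟩
          Hₖ₀ * G fzero K * σ β * Gₖ₀         ≈⟨ solve 4 (λ h g′ y g → h :* g′ :* y :* g := h :* (y :* (g′ :* g)))
                                                  refl Hₖ₀ (G fzero K) (σ β) Gₖ₀ ⟩
          Hₖ₀ * (σ β * (G fzero K * Gₖ₀))     ≈⟨ *-congˡ (*-congˡ (|G|² λ ())) ⟩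
          Hₖ₀ * (σ β * b)                     ≈⟨ *-congˡ σβb≈1 ⟩
          Hₖ₀ * 1#                            ≈⟨ *-identityʳ _ ⟩
          Hₖ₀                                 ∎)
          where K = fsuc k; Hₖ₀ = H K fzero; Gₖ₀ = G K fzero

        gram-ₖⱼ : TriplesAgree B φ ψ → ∀ {k j} → k ≢ j →
          H (fsuc k) (fsuc j) ≈ σ (t (fsuc k)) * t (fsuc j) * G (fsuc k) (fsuc j)
        gram-ₖⱼ agree {k} {j} k≢j = sym (begin
          σ (t K) * t J * G K J
            ≈⟨ *-congʳ (*-congʳ (σ-t k)) ⟩
          H K 0ᶠ * G 0ᶠ K * σ β * (H 0ᶠ J * G J 0ᶠ * β) * G K J
            ≈⟨ solve 7 (λ hk0 g0k y h0j gj0 x gkj →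
                 hk0 :* g0k :* y :* (h0j :* gj0 :* x) :* gkj :=
                 hk0 :* h0j :* (g0k :* gkj :* gj0) :* (y :* x))
               refl (H K 0ᶠ) (G 0ᶠ K) (σ β) (H 0ᶠ J) (G J 0ᶠ) β (G K J) ⟩
          H K 0ᶠ * H 0ᶠ J * (G 0ᶠ K * G K J * G J 0ᶠ) * (σ β * β)
            ≈⟨ *-congʳ (*-congˡ (triplesAgree⇒Δ₀-agree agree k≢j)) ⟩
          H K 0ᶠ * H 0ᶠ J * (H 0ᶠ K * H K J * H J 0ᶠ) * (σ β * β)
            ≈⟨ solve 6 (λ hk0 h0j h0k hkj hj0 y →
                 hk0 :* h0j :* (h0k :* hkj :* hj0) :* y :=
                 hkj :* (y :* (h0k :* hk0) :* (h0j :* hj0)))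
               refl (H K 0ᶠ) (H 0ᶠ J) (H 0ᶠ K) (H K J) (H J 0ᶠ) (σ β * β) ⟩
          H K J * (σ β * β * (H 0ᶠ K * H K 0ᶠ) * (H 0ᶠ J * H J 0ᶠ))
            ≈⟨ *-congˡ (*-cong (*-congˡ (|H|² λ ())) (|H|² λ ())) ⟩
          H K J * (σ β * β * b * b)
            ≈⟨ *-congˡ (solve 3 (λ y x b → y :* x :* b :* b := y :* b :* (b :* x)) refl (σ β) β b) ⟩
          H K J * (σ β * b * (b * β))
            ≈⟨ *-congˡ (*-cong σβb≈1 bβ≈1) ⟩
          H K J * (1# * 1#)
            ≈⟨ *-congˡ (*-identityˡ 1#) ⟩
          H K J * 1#
            ≈⟨ *-identityʳ _ ⟩
          H K J ∎)
          where K = fsuc k; J = fsuc j; 0ᶠ = fzero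

        gram : TriplesAgree B φ ψ → GramRelated B t φ ψ
        gram agree fzero    fzero    = diagonal-related eqφ eqψ t-unit fzero
        gram agree fzero    (fsuc j) = gram-0ⱼ j
        gram agree (fsuc k) fzero    = gram-ₖ0 k
        gram agree (fsuc k) (fsuc j) with k ≟ j
        ... | yes ≡.refl = diagonal-related eqφ eqψ t-unit (fsuc k)
        ... | no k≢j     = gram-ₖⱼ agree k≢j

      gramEquivalent⇔triplesAgree : ∀ {n} {φ ψ : Fin n → Vec d} →
        IsEquiangular B a b φ → IsEquiangular B a b ψ → GramEquivalent B φ ψ ⇔ TriplesAgree B φ ψ
      gramEquivalent⇔triplesAgree eqφ eqψ = mk⇔ gramEquivalent⇒triplesAgree (triplesAgree⇒gramEquivalent eqφ eqψ)
        where
        triplesAgree⇒gramEquivalent : ∀ {n} {φ ψ : Fin n → Vec d} →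
          IsEquiangular B a b φ → IsEquiangular B a b ψ → TriplesAgree B φ ψ → GramEquivalent B φ ψ
        triplesAgree⇒gramEquivalent {ℕ.zero}  _   _   _     = (λ ()) , (λ ()) , (λ ())
        triplesAgree⇒gramEquivalent {ℕ.suc m} eqφ eqψ agree with b ≟₀ 0#
        ... | yes b≈0 = orthogonal⇒gramEquivalent eqφ eqψ b≈0
        ... | no b≉0  = t , t-unit , gram agree
          where open Normalised eqφ eqψ b≉0

corollary3p11 : {c ℓ : Level} (R : CommutativeRing c ℓ)
    (σ : CommutativeRing.Carrier R → CommutativeRing.Carrier R) →
    let open CommutativeRing R
        open Herm R σ
    in IsField → (q : ℕ) → Odd q → (CaseU q ⊎ CaseO q) →
       (d : ℕ) (B : Vec d → Vec d → Carrier) → IsHermitianForm B →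
       (a b : Carrier) → σ a ≈ a → σ b ≈ b →
       (n : ℕ) (φ ψ : Fin n → Vec d) →
       IsEquiangular B a b φ → IsEquiangular B a b ψ →
       IsFrame φ → IsFrame ψ →
       SwitchingEquivalent B φ ψ ⇔
         (∀ (j k l : Fin n) → j < k → k < l →
            Δ B (φ j) (φ k) (φ l) ≈ Δ B (ψ j) (ψ k) (ψ l))
corollary3p11 R σ isField q q-odd case d B isHermitian a b _ σb≈b n φ ψ eqφ eqψ frameφ frameψ =
  gramEquivalent⇔triplesAgree eqφ eqψ ⇔-∘ switching⇔gramEquivalent frameφ frameψ
  where
  open Switching R σ
  open Form (σ-isMonoidHomomorphism q case) (σ-0# q q-odd case) isHermitian
  open Equiangular isField (case⇒decidable q case) σb≈b
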